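{- Let $(y_n)_{n\ge 1}$ be a nondecreasing sequence of positive integers with output array $A(n,k)$. Let $k\ge 0$ and let $N\ge1$ be an integer such that $k\le y_{N+1}$. Then for every integer $n\ge 2$, $$A(N+n-1,k)=\binom{n+k-2}{k}+\sum_{j=1}^{k}\binom{n+k-2-j}{k-j}A(N,j).$$
   Context: Let $(y_n)_{n\ge1}$ be a nondecreasing sequence of positive integers (an input sequence). For a positive integer $n$, an $n$-tuple $\mathbf{x}=(x_1,\dots,x_n)$ of nonnegative integers is called valid for $(y_n)$ if $x_1\le y_n$ and $x_{j+1}\le \min(x_j,y_{n-j})$ for $1\le j\le n-1$. For $n\ge1$ and $k\ge0$, $A(n,k)$ denotes the number of valid $n$-tuples with $x_1=k$; the array $(A(n,k))$ is the output array of $(y_n)$. -}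

module Defs where

open import Data.Nat using (ℕ; zero; suc; _+_; _∸_; _≤_; _<_; _≤?_; _≟_)
open import Data.Nat.Combinatorics using (_C_)
open import Data.Product using (_×_; _,_)
open import Data.Vec using (Vec; []; _∷_)
open import Data.List using (List; []; _∷_; length; filter; map; concatMap; upTo)
open import Data.Unit using (⊤)
open import Data.Empty using (⊥)
open import Relation.Binary.PropositionalEquality using (_≡_)
open import Relation.Nullary using (Dec; yes; no)
open import Relation.Nullary.Decidable using (_×-dec_)

-- A sequence y : ℕ → ℕ represents (y_n)_{n ≥ 1}; the value y 0 is ignored.
NondecPos : (ℕ → ℕ) → Set
NondecPos y = (∀ i → 1 ≤ i → 1 ≤ y i) × (∀ i j → 1 ≤ i → i ≤ j → y i ≤ y j)

-- ValidTail y m p xs : the remaining m entries x_{j+1},...,x_n (with m = n - j)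
-- satisfy x_{j+1} ≤ min(x_j, y_{n-j}) where p = x_j; recursively.
ValidTail : (ℕ → ℕ) → (m : ℕ) → ℕ → Vec ℕ m → Set
ValidTail y zero p [] = ⊤
ValidTail y (suc m) p (x ∷ xs) = (x ≤ p × x ≤ y (suc m)) × ValidTail y m x xs

Valid : (ℕ → ℕ) → (n : ℕ) → Vec ℕ n → Set
Valid y zero [] = ⊤
Valid y (suc n) (x ∷ xs) = x ≤ y (suc n) × ValidTail y n x xs

validTail? : (y : ℕ → ℕ) → (m : ℕ) → (p : ℕ) → (xs : Vec ℕ m) → Dec (ValidTail y m p xs)
validTail? y zero p [] = yes _
validTail? y (suc m) p (x ∷ xs) = ((x ≤? p) ×-dec (x ≤? y (suc m))) ×-dec validTail? y m x xs

boxVecs : (m : ℕ) → ℕ → List (Vec ℕ m)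
boxVecs zero b = [] ∷ []
boxVecs (suc m) b = concatMap (λ x → map (x ∷_) (boxVecs m b)) (upTo (suc b))

valid? : (y : ℕ → ℕ) → (n : ℕ) → (xs : Vec ℕ n) → Dec (Valid y n xs)
valid? y zero [] = yes _
valid? y (suc n) (x ∷ xs) = (x ≤? y (suc n)) ×-dec validTail? y n x xs

HeadIs : ℕ → {n : ℕ} → Vec ℕ n → Set
HeadIs k [] = ⊥
HeadIs k (x ∷ xs) = x ≡ k

headIs? : (k : ℕ) → {n : ℕ} → (xs : Vec ℕ n) → Dec (HeadIs k xs)
headIs? k [] = no (λ ())
headIs? k (x ∷ xs) = x ≟ k

-- A(n,k) = number of valid n-tuples with x_1 = k.  Every valid n-tuple has all
-- entries ≤ x_1 ≤ y_n, so it lies in the finite box {0..y_n}^n enumerated here.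
A : (ℕ → ℕ) → ℕ → ℕ → ℕ
A y n k = length (filter (λ xs → headIs? k xs ×-dec valid? y n xs) (boxVecs n (y n)))

sum1 : ℕ → (ℕ → ℕ) → ℕ
sum1 zero f = 0
sum1 (suc k) f = sum1 k f + f (suc k)

-- A valid tuple is a first entry followed by a valid tail, so the number of tails of length m
-- after an entry p satisfies t(m, p) = Σ_{x ≤ min(p, y_m)} t(m - 1, x). Once p ≤ k ≤ y_{N+1} ≤ y_m
-- the minimum is p, so each of the n - 2 steps above length N only takes partial sums, starting
-- from t(N, p) = Σ_{j ≤ p} A(N, j). The r-fold partial sums of f are Σ_{j ≤ p} C(r - 1 + p - j, p - j) f(j)
-- by Pascal's rule, and A(N, 0) = 1 gives the leading binomial.
module Submission where

open import Defs
open import Data.Nat using (ℕ; zero; suc; _+_; _*_; _∸_; _≤_; _<_; _⊓_; z≤n; s≤s)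
open import Data.Nat.Properties
open import Data.Nat.Combinatorics using (_C_; nCn≡1; nCk+nC[k+1]≡[n+1]C[k+1])
open import Algebra.Properties.CommutativeSemigroup +-commutativeSemigroup using () renaming (interchange to +-interchange)
open import Data.Nat.ListAction using (sum)
open import Data.Nat.ListAction.Properties using (sum-++)
open import Data.List using (List; []; _∷_; _++_; _∷ʳ_; length; filter; map; concatMap; upTo)
open import Data.List.Properties using (length-++; filter-++; filter-≐; filter-none; map-++; map-cong; upTo-∷ʳ)
open import Data.List.Relation.Unary.All using (universal)
open import Data.Vec using (Vec; _∷_)
open import Data.Product using (_×_; _,_; proj₁; proj₂)
open import Data.Sum using (inj₁; inj₂)
open import Data.Bool using (true; false)
open import Function using (_∘_)
open import Relation.Nullary using (¬_; does)
open import Relation.Nullary.Decidable using (_×-dec_)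
open import Relation.Unary using (Decidable; _≐_)
open import Relation.Binary.PropositionalEquality using (_≡_; _≢_; refl; sym; trans; cong; cong₂; module ≡-Reasoning)

sumTo : ℕ → (ℕ → ℕ) → ℕ
sumTo zero    f = f 0
sumTo (suc n) f = sumTo n f + f (suc n)

sumTo-cong : ∀ n {f g : ℕ → ℕ} → (∀ j → j ≤ n → f j ≡ g j) → sumTo n f ≡ sumTo n g
sumTo-cong zero    f≗g = f≗g 0 z≤n
sumTo-cong (suc n) f≗g = cong₂ _+_ (sumTo-cong n (λ j j≤n → f≗g j (m≤n⇒m≤1+n j≤n))) (f≗g (suc n) ≤-refl)

sumTo-+ : ∀ n (f g : ℕ → ℕ) → sumTo n (λ j → f j + g j) ≡ sumTo n f + sumTo n g
sumTo-+ zero    f g = refl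
sumTo-+ (suc n) f g = begin
  sumTo n (λ j → f j + g j) + (f (suc n) + g (suc n))  ≡⟨ cong (_+ (f (suc n) + g (suc n))) (sumTo-+ n f g) ⟩
  sumTo n f + sumTo n g + (f (suc n) + g (suc n))      ≡⟨ +-interchange (sumTo n f) (sumTo n g) _ _ ⟩
  sumTo n f + f (suc n) + (sumTo n g + g (suc n))      ∎
  where
  open ≡-Reasoning

sumTo-zero : ∀ n {f : ℕ → ℕ} → (∀ j → j ≤ n → f j ≡ 0) → sumTo n f ≡ 0
sumTo-zero n f≗0 = trans (sumTo-cong n f≗0) (zeros n)
  where
  zeros : ∀ n → sumTo n (λ _ → 0) ≡ 0
  zeros zero    = refl
  zeros (suc n) = trans (+-identityʳ _) (zeros n)

sumTo-trailing-zeros : ∀ {m n} {f : ℕ → ℕ} → m ≤ n → (∀ j → m < j → j ≤ n → f j ≡ 0) → sumTo n f ≡ sumTo m f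
sumTo-trailing-zeros m≤n tail≗0 with m≤n⇒m<n∨m≡n m≤n
... | inj₂ refl = refl
sumTo-trailing-zeros {m} {suc n} {f} _ tail≗0 | inj₁ (s≤s m≤n) = begin
  sumTo n f + f (suc n)  ≡⟨ cong₂ _+_ (sumTo-trailing-zeros m≤n (λ j m<j j≤n → tail≗0 j m<j (m≤n⇒m≤1+n j≤n)))
                                     (tail≗0 (suc n) (s≤s m≤n) ≤-refl) ⟩
  sumTo m f + 0          ≡⟨ +-identityʳ _ ⟩
  sumTo m f              ∎
  where open ≡-Reasoning

sumTo-restrict : ∀ {m n} {f g : ℕ → ℕ} → m ≤ n → (∀ j → j ≤ m → f j ≡ g j) → (∀ j → m < j → j ≤ n → f j ≡ 0) →
                 sumTo n f ≡ sumTo m g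
sumTo-restrict {m} m≤n f≗g tail≗0 = trans (sumTo-trailing-zeros m≤n tail≗0) (sumTo-cong m f≗g)

sumTo-single : ∀ {k n} {f : ℕ → ℕ} → k ≤ n → (∀ j → j ≢ k → f j ≡ 0) → sumTo n f ≡ f k
sumTo-single {zero}  0≤n f≗0 =
  sumTo-trailing-zeros 0≤n (λ j 0<j _ → f≗0 j (λ { refl → <-irrefl refl 0<j }))
sumTo-single {suc k} {n} {f} k<n f≗0 = begin
  sumTo n f             ≡⟨ sumTo-trailing-zeros k<n (λ j k<j _ → f≗0 j (λ { refl → <-irrefl refl k<j })) ⟩
  sumTo k f + f (suc k) ≡⟨ cong (_+ f (suc k)) (sumTo-zero k (λ j j≤k → f≗0 j (λ { refl → 1+n≰n j≤k }))) ⟩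
  f (suc k)             ∎
  where open ≡-Reasoning

sumTo≡head+sum1 : ∀ n (f : ℕ → ℕ) → sumTo n f ≡ f 0 + sum1 n f
sumTo≡head+sum1 zero    f = sym (+-identityʳ (f 0))
sumTo≡head+sum1 (suc n) f = trans (cong (_+ f (suc n)) (sumTo≡head+sum1 n f)) (+-assoc (f 0) _ _)

sum-map-upTo : ∀ n (f : ℕ → ℕ) → sum (map f (upTo (suc n))) ≡ sumTo n f
sum-map-upTo zero    f = +-identityʳ (f 0)
sum-map-upTo (suc n) f = begin
  sum (map f (upTo (suc (suc n))))                 ≡⟨ cong (sum ∘ map f) (sym (upTo-∷ʳ (suc n))) ⟩
  sum (map f (upTo (suc n) ∷ʳ suc n))              ≡⟨ cong sum (map-++ f (upTo (suc n)) _) ⟩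
  sum (map f (upTo (suc n)) ++ f (suc n) ∷ [])     ≡⟨ sum-++ (map f (upTo (suc n))) _ ⟩
  sum (map f (upTo (suc n))) + (f (suc n) + 0)     ≡⟨ cong₂ _+_ (sum-map-upTo n f) (+-identityʳ _) ⟩
  sumTo n f + f (suc n)                            ∎
  where open ≡-Reasoning

iteratedSum : ℕ → (ℕ → ℕ) → ℕ → ℕ
iteratedSum zero    f   = f
iteratedSum (suc r) f p = sumTo p (iteratedSum r f)

binomialSum : ℕ → (ℕ → ℕ) → ℕ → ℕ
binomialSum r f p = sumTo p (λ j → ((r + (p ∸ j)) C (p ∸ j)) * f j)

[1+r+d]Cd+[r+1+d]C[1+d]≡[1+r+1+d]C[1+d] : ∀ r d → (suc r + d) C d + (r + suc d) C suc d ≡ (suc r + suc d) C suc d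
[1+r+d]Cd+[r+1+d]C[1+d]≡[1+r+1+d]C[1+d] r d = begin
  (suc r + d) C d + (r + suc d) C suc d  ≡⟨ cong (λ n → (suc r + d) C d + n C suc d) (+-suc r d) ⟩
  (suc r + d) C d + (suc r + d) C suc d  ≡⟨ nCk+nC[k+1]≡[n+1]C[k+1] (suc r + d) d ⟩
  suc (suc r + d) C suc d                ≡⟨ cong (λ n → suc n C suc d) (sym (+-suc r d)) ⟩
  (suc r + suc d) C suc d                ∎
  where open ≡-Reasoning

binomialSum-pascal : ∀ r (f : ℕ → ℕ) p → binomialSum (suc r) f p + binomialSum r f (suc p) ≡ binomialSum (suc r) f (suc p)
binomialSum-pascal r f p = begin
  binomialSum (suc r) f p + (sumTo p (weighted r) + last r)  ≡⟨ sym (+-assoc (binomialSum (suc r) f p) _ _) ⟩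
  binomialSum (suc r) f p + sumTo p (weighted r) + last r    ≡⟨ cong₂ _+_ (sym (sumTo-+ p _ _)) (trans (last≡ r) (sym (last≡ (suc r)))) ⟩
  sumTo p (λ j → ((suc r + (p ∸ j)) C (p ∸ j)) * f j + weighted r j) + last (suc r)            ≡⟨ cong (_+ last (suc r)) (sumTo-cong p pointwise) ⟩
  sumTo p (weighted (suc r)) + last (suc r)                  ∎
  where
  open ≡-Reasoning
  weighted : ℕ → ℕ → ℕ
  weighted s j = ((s + (suc p ∸ j)) C (suc p ∸ j)) * f j
  last : ℕ → ℕ
  last s = weighted s (suc p)
  last≡ : ∀ s → last s ≡ f (suc p)
  last≡ s rewrite n∸n≡0 p = +-identityʳ (f (suc p))
  pointwise : ∀ j → j ≤ p → ((suc r + (p ∸ j)) C (p ∸ j)) * f j + weighted r j ≡ weighted (suc r) j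
  pointwise j j≤p rewrite +-∸-assoc 1 j≤p =
    trans (sym (*-distribʳ-+ (f j) ((suc r + (p ∸ j)) C (p ∸ j)) ((r + suc (p ∸ j)) C suc (p ∸ j))))
          (cong (_* f j) ([1+r+d]Cd+[r+1+d]C[1+d]≡[1+r+1+d]C[1+d] r (p ∸ j)))

iteratedSum≡binomialSum : ∀ r (f : ℕ → ℕ) p → iteratedSum (suc r) f p ≡ binomialSum r f p
iteratedSum≡binomialSum zero    f p       =
  sumTo-cong p (λ j _ → sym (trans (cong (_* f j) (nCn≡1 (p ∸ j))) (*-identityˡ (f j))))
iteratedSum≡binomialSum (suc r) f zero    = iteratedSum≡binomialSum r f zero
iteratedSum≡binomialSum (suc r) f (suc p) =
  trans (cong₂ _+_ (iteratedSum≡binomialSum (suc r) f p) (iteratedSum≡binomialSum r f (suc p)))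
        (binomialSum-pascal r f p)

module _ {A : Set} {P : A → Set} (P? : Decidable P) where

  length-filter-concatMap : ∀ {B : Set} (g : B → List A) xs →
                            length (filter P? (concatMap g xs)) ≡ sum (map (λ x → length (filter P? (g x))) xs)
  length-filter-concatMap g []       = refl
  length-filter-concatMap g (x ∷ xs) = begin
    length (filter P? (g x ++ concatMap g xs))                 ≡⟨ cong length (filter-++ P? (g x) _) ⟩
    length (filter P? (g x) ++ filter P? (concatMap g xs))     ≡⟨ length-++ (filter P? (g x)) ⟩
    length (filter P? (g x)) + length (filter P? (concatMap g xs)) ≡⟨ cong (_ +_) (length-filter-concatMap g xs) ⟩
    _                                                           ∎
    where open ≡-Reasoning

  length-filter-map : ∀ {B : Set} (g : B → A) xs → length (filter P? (map g xs)) ≡ length (filter (P? ∘ g) xs)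
  length-filter-map g []       = refl
  length-filter-map g (x ∷ xs) with does (P? (g x))
  ... | true  = cong suc (length-filter-map g xs)
  ... | false = length-filter-map g xs

  length-filter-∅ : (∀ x → ¬ P x) → ∀ xs → length (filter P? xs) ≡ 0
  length-filter-∅ ¬P xs = cong length (filter-none P? (universal ¬P xs))

length-filter-≐ : ∀ {A : Set} {P Q : A → Set} (P? : Decidable P) (Q? : Decidable Q) → P ≐ Q →
                  ∀ xs → length (filter P? xs) ≡ length (filter Q? xs)
length-filter-≐ P? Q? P≐Q xs = cong length (filter-≐ P? Q? P≐Q xs)

length-filter-boxVecs : ∀ {m} {P : Vec ℕ (suc m) → Set} (P? : Decidable P) b →
  length (filter P? (boxVecs (suc m) b)) ≡ sumTo b (λ x → length (filter (P? ∘ (x ∷_)) (boxVecs m b)))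
length-filter-boxVecs {m} P? b =
  trans (length-filter-concatMap P? (λ x → map (x ∷_) (boxVecs m b)) (upTo (suc b)))
        (trans (cong sum (map-cong (λ x → length-filter-map P? (x ∷_) (boxVecs m b)) (upTo (suc b))))
               (sum-map-upTo b _))

tailCount : (ℕ → ℕ) → ℕ → ℕ → ℕ
tailCount y zero    p = 1
tailCount y (suc m) p = sumTo (p ⊓ y (suc m)) (tailCount y m)

tailCount-0 : ∀ y m → tailCount y m 0 ≡ 1
tailCount-0 y zero    = refl
tailCount-0 y (suc m) = tailCount-0 y m

count-validTail : ∀ y m {p b} → p ≤ b → length (filter (validTail? y m p) (boxVecs m b)) ≡ tailCount y m p
count-validTail y zero    p≤b = refl
count-validTail y (suc m) {p} {b} p≤b =
  trans (length-filter-boxVecs (validTail? y (suc m) p) b)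
        (sumTo-restrict (≤-trans (m⊓n≤m p _) p≤b) allowed forbidden)
  where
  c : ℕ
  c = p ⊓ y (suc m)
  allowed : ∀ x → x ≤ c → length (filter (validTail? y (suc m) p ∘ (x ∷_)) (boxVecs m b)) ≡ tailCount y m x
  allowed x x≤c = trans (length-filter-≐ _ (validTail? y m x) (proj₂ , (λ v → bounds , v)) (boxVecs m b))
                        (count-validTail y m (≤-trans (≤-trans x≤c (m⊓n≤m p _)) p≤b))
    where
    bounds : x ≤ p × x ≤ y (suc m)
    bounds = ≤-trans x≤c (m⊓n≤m p _) , ≤-trans x≤c (m⊓n≤n p _)
  forbidden : ∀ x → c < x → x ≤ b → length (filter (validTail? y (suc m) p ∘ (x ∷_)) (boxVecs m b)) ≡ 0
  forbidden x c<x _ = length-filter-∅ _ (λ { _ ((x≤p , x≤y) , _) → <⇒≱ c<x (⊓-glb x≤p x≤y) }) (boxVecs m b)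

module _ (y : ℕ → ℕ) (n k : ℕ) where
  private
    firstIs? : Decidable (λ xs → HeadIs k xs × Valid y (suc n) xs)
    firstIs? xs = headIs? k xs ×-dec valid? y (suc n) xs

    startingWith : ℕ → ℕ
    startingWith x = length (filter (firstIs? ∘ (x ∷_)) (boxVecs n (y (suc n))))

    startingWith-≢ : ∀ x → x ≢ k → startingWith x ≡ 0
    startingWith-≢ x x≢k = length-filter-∅ (firstIs? ∘ (x ∷_)) (λ _ → x≢k ∘ proj₁) (boxVecs n (y (suc n)))

  A-suc : k ≤ y (suc n) → A y (suc n) k ≡ tailCount y n k
  A-suc k≤y = begin
    A y (suc n) k                                             ≡⟨ length-filter-boxVecs firstIs? (y (suc n)) ⟩
    sumTo (y (suc n)) startingWith                            ≡⟨ sumTo-single k≤y startingWith-≢ ⟩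
    startingWith k                                            ≡⟨ length-filter-≐ (firstIs? ∘ (k ∷_)) (validTail? y n k)
                                                                   ((λ { (_ , _ , v) → v }) , (λ v → refl , k≤y , v)) (boxVecs n (y (suc n))) ⟩
    length (filter (validTail? y n k) (boxVecs n (y (suc n)))) ≡⟨ count-validTail y n k≤y ⟩
    tailCount y n k                                           ∎
    where open ≡-Reasoning

  A-suc-beyond : y (suc n) < k → A y (suc n) k ≡ 0
  A-suc-beyond y<k = trans (length-filter-boxVecs firstIs? (y (suc n)))
    (sumTo-zero (y (suc n)) (λ x x≤y → startingWith-≢ x (λ { refl → <⇒≱ y<k x≤y })))

tailCount≡sumTo-A : ∀ y n p → tailCount y (suc n) p ≡ sumTo p (A y (suc n))
tailCount≡sumTo-A y n p = sym (sumTo-restrict (m⊓n≤m p (y (suc n))) inRange beyond)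
  where
  inRange : ∀ j → j ≤ p ⊓ y (suc n) → A y (suc n) j ≡ tailCount y n j
  inRange j j≤c = A-suc y n j (≤-trans j≤c (m⊓n≤n p _))
  beyond : ∀ j → p ⊓ y (suc n) < j → j ≤ p → A y (suc n) j ≡ 0
  beyond j c<j j≤p = A-suc-beyond y n j (≰⇒> (λ j≤y → <⇒≱ c<j (⊓-glb j≤p j≤y)))

tailCount≡iteratedSum : ∀ y n k → (∀ i → suc n < i → k ≤ y i) →
                        ∀ r p → p ≤ k → tailCount y (r + suc n) p ≡ iteratedSum (suc r) (A y (suc n)) p
tailCount≡iteratedSum y n k k≤y zero    p p≤k = tailCount≡sumTo-A y n p
tailCount≡iteratedSum y n k k≤y (suc r) p p≤k = begin
  sumTo (p ⊓ y (suc (r + suc n))) (tailCount y (r + suc n))  ≡⟨ cong (λ c → sumTo c _) (m≤n⇒m⊓n≡m p≤y) ⟩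
  sumTo p (tailCount y (r + suc n))                          ≡⟨ sumTo-cong p (λ j j≤p → tailCount≡iteratedSum y n k k≤y r j (≤-trans j≤p p≤k)) ⟩
  sumTo p (iteratedSum (suc r) (A y (suc n)))                ∎
  where
  open ≡-Reasoning
  p≤y : p ≤ y (suc (r + suc n))
  p≤y = ≤-trans p≤k (k≤y _ (s≤s (m≤n+m (suc n) r)))

theorem3p1 : (y : ℕ → ℕ) → NondecPos y → (k N : ℕ) → 1 ≤ N → k ≤ y (N + 1) →
    (n : ℕ) → 2 ≤ n →
    A y (N + n ∸ 1) k ≡ ((n + k ∸ 2) C k) + sum1 k (λ j → ((n + k ∸ 2 ∸ j) C (k ∸ j)) * A y N j)
theorem3p1 y _ k zero () _ _ _
theorem3p1 y _ k (suc n) _ _ zero ()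
theorem3p1 y _ k (suc n) _ _ (suc zero) (s≤s ())
theorem3p1 y (_ , mono) k (suc n) _ k≤y (suc (suc m)) _ = begin
  A y (n + suc (suc m)) k                                        ≡⟨ cong (λ l → A y l k) length≡ ⟩
  A y (suc (m + suc n)) k                                        ≡⟨ A-suc y (m + suc n) k (k≤ _ (s≤s (m≤n+m (suc n) m))) ⟩
  tailCount y (m + suc n) k                                      ≡⟨ tailCount≡iteratedSum y n k k≤ m k ≤-refl ⟩
  iteratedSum (suc m) (A y (suc n)) k                            ≡⟨ iteratedSum≡binomialSum m (A y (suc n)) k ⟩
  sumTo k (λ j → ((m + (k ∸ j)) C (k ∸ j)) * A y (suc n) j)      ≡⟨ sumTo-cong k (λ j j≤k → cong (λ l → (l C (k ∸ j)) * A y (suc n) j) (sym (+-∸-assoc m j≤k))) ⟩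
  sumTo k (λ j → ((m + k ∸ j) C (k ∸ j)) * A y (suc n) j)        ≡⟨ sumTo≡head+sum1 k _ ⟩
  ((m + k) C k) * A y (suc n) 0 + rest                           ≡⟨ cong (λ a → ((m + k) C k) * a + rest) (trans (A-suc y n 0 z≤n) (tailCount-0 y n)) ⟩
  ((m + k) C k) * 1 + rest                                       ≡⟨ cong (_+ rest) (*-identityʳ _) ⟩
  ((m + k) C k) + rest                                           ∎
  where
  open ≡-Reasoning
  rest : ℕ
  rest = sum1 k (λ j → ((m + k ∸ j) C (k ∸ j)) * A y (suc n) j)
  length≡ : n + suc (suc m) ≡ suc (m + suc n)
  length≡ = trans (+-comm n (suc (suc m))) (cong suc (sym (+-suc m n)))
  k≤ : ∀ i → suc n < i → k ≤ y i
  k≤ i n<i = ≤-trans k≤y (mono (suc n + 1) i (s≤s z≤n) (≤-trans (≤-reflexive (+-comm (suc n) 1)) n<i))
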